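{- Let $G$ be a graph and let $\{X,Y\}$ be a partition of $V(G)$ such that every vertex of $X$ is adjacent to every vertex of $Y$. Then $G$ has a triangle packing of size at least $\min\{1,\frac{|Y|}{\chi'(G[X])}\}\,|E(G[X])|$. Moreover, every triangle in such a packing has exactly two vertices in $X$ and one vertex in $Y$.
   Context: A triangle packing of a graph is a set of pairwise edge-disjoint triangles of the graph. $G[X]$ denotes the subgraph induced by $X$, and $\chi'(H)$ denotes the chromatic index of $H$ (the minimum number of matchings partitioning $E(H)$). -}

module Defs where

open import Data.Nat using (ℕ; zero; suc; _+_; _*_; _≤_; _<ᵇ_)
open import Data.Nat.Base using (_⊓_)
open import Data.Bool using (Bool; true; false; if_then_else_; _∧_; not)
open import Data.Fin using (Fin; toℕ) renaming (zero to fzero; suc to fsuc)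
open import Data.Product using (Σ; ∃; _×_; _,_)
open import Data.Sum using (_⊎_)
open import Data.Empty using (⊥)
open import Relation.Binary.PropositionalEquality using (_≡_; _≢_)

record Graph (n : ℕ) : Set where
  field
    adj    : Fin n → Fin n → Bool
    sym    : ∀ u v → adj u v ≡ adj v u
    irrefl : ∀ u → adj u u ≡ false
open Graph public

sumFin : ∀ {n} → (Fin n → ℕ) → ℕ
sumFin {zero}  f = 0
sumFin {suc n} f = f fzero + sumFin (λ i → f (fsuc i))

ind : Bool → ℕ
ind true  = 1
ind false = 0

count : ∀ {n} → (Fin n → Bool) → ℕ
count f = sumFin (λ i → ind (f i))

edgeCount : ∀ {n} → Graph n → ℕ
edgeCount G = sumFin (λ i → sumFin (λ j → ind ((toℕ i <ᵇ toℕ j) ∧ adj G i j)))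

-- Induced subgraph G[X]; vertices outside X are kept as isolated vertices
-- (this changes neither |E| nor χ').
induced : ∀ {n} → Graph n → (Fin n → Bool) → Graph n
induced {n} G X = record { adj = a ; sym = s ; irrefl = r }
  where
  a : Fin n → Fin n → Bool
  a u v = X u ∧ X v ∧ adj G u v
  s : ∀ u v → a u v ≡ a v u
  s u v with X u | X v
  ... | true  | true  = sym G u v
  ... | true  | false = Relation.Binary.PropositionalEquality.refl
  ... | false | true  = Relation.Binary.PropositionalEquality.refl
  ... | false | false = Relation.Binary.PropositionalEquality.refl
  r : ∀ u → a u u ≡ false
  r u with X u
  ... | true  = irrefl G u
  ... | false = Relation.Binary.PropositionalEquality.refl

record EdgeColouring {n} (G : Graph n) (k : ℕ) : Set where
  field
    col      : Fin n → Fin n → Fin k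
    col-sym  : ∀ u v → adj G u v ≡ true → col u v ≡ col v u
    proper   : ∀ u v w → adj G u v ≡ true → adj G u w ≡ true → v ≢ w →
               col u v ≢ col u w

IsChromaticIndex : ∀ {n} → Graph n → ℕ → Set
IsChromaticIndex G c = EdgeColouring G c × (∀ k → EdgeColouring G k → c ≤ k)

record Triangle {n} (G : Graph n) : Set where
  field
    a b c : Fin n
    ab : adj G a b ≡ true
    bc : adj G b c ≡ true
    ac : adj G a c ≡ true
open Triangle public

_∈T_ : ∀ {n} {G : Graph n} → Fin n → Triangle G → Set
u ∈T t = u ≡ a t ⊎ u ≡ b t ⊎ u ≡ c t

EdgeDisjoint : ∀ {n} {G : Graph n} → Triangle G → Triangle G → Set
EdgeDisjoint s t = ∀ u v → u ≢ v → u ∈T s → v ∈T s → u ∈T t → v ∈T t → ⊥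

IsPacking : ∀ {n} {G : Graph n} {m} → (Fin m → Triangle G) → Set
IsPacking {m = m} t = ∀ (i j : Fin m) → i ≢ j → EdgeDisjoint (t i) (t j)

TwoInX : ∀ {n} {G : Graph n} → (Fin n → Bool) → Triangle G → Set
TwoInX X t = ind (X (a t)) + ind (X (b t)) + ind (X (c t)) ≡ 2

module Submission where

-- Fix a proper colouring of G[X] with χ colours and let k = min(χ, |Y|). The k largest colour
-- classes hold at least k/χ of the edges of G[X]; give each of them its own apex y ∈ Y and turn
-- every edge uv of the class of y into the triangle uvy. An edge inside X lies in one class, so
-- in one triangle; an edge xy fixes the class of y, in which x lies on at most one edge because
-- colour classes are matchings. Hence the triangles are pairwise edge-disjoint.

open import Defs hiding (sym)
open import Data.Nat using (ℕ; zero; suc; _+_; _*_; _≤_; _⊓_; _≟_; z≤n; s≤s⁻¹)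
open import Data.Nat.Properties
  using (+-0-commutativeMonoid; +-assoc; +-mono-≤; *-comm; *-distribˡ-+; ≤-refl; ≤-trans; _≤?_;
         <⇒≤; ≰⇒>; ≤∧≢⇒<; m⊓n≤m; m⊓n≤n; module ≤-Reasoning)
open import Data.Bool using (Bool; true; false; not; _∧_; T)
open import Data.Bool.Properties using (T-≡; T-not-≡)
open import Data.Fin using (Fin; _<_; punchIn; inject≤; combine; remQuot; _↑ˡ_; _↑ʳ_)
  renaming (zero to fzero; suc to fsuc)
import Data.Fin.Properties as Fin
open import Data.Product using (Σ; ∃; _×_; _,_; proj₁; proj₂; map₂)
open import Data.Sum using (_⊎_; inj₁; inj₂)
open import Data.Empty using (⊥-elim)
open import Function using (_∘_; Injective)
open import Function.Bundles using (Injection; Equivalence)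
open import Function.Properties.Inverse using (↔⇒↣)
open import Relation.Binary using (Rel; Asymmetric; Decidable)
open import Relation.Binary.PropositionalEquality
open import Relation.Nullary using (Dec; yes; no; does; T?; _×-dec_)
open import Relation.Nullary.Decidable using (map; decidable-stable)
open import Algebra.Properties.CommutativeMonoid.Sum +-0-commutativeMonoid
  using (sum; ∑-comm; sum-remove)

sumFin≡sum : ∀ {n} (f : Fin n → ℕ) → sumFin f ≡ sum f
sumFin≡sum {zero}  f = refl
sumFin≡sum {suc n} f = cong (f fzero +_) (sumFin≡sum (f ∘ fsuc))

sumFin-cong : ∀ {n} {f g : Fin n → ℕ} → (∀ i → f i ≡ g i) → sumFin f ≡ sumFin g
sumFin-cong {zero}  f≗g = refl
sumFin-cong {suc n} f≗g = cong₂ _+_ (f≗g fzero) (sumFin-cong (f≗g ∘ fsuc))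

sumFin-zero : ∀ n → sumFin {n} (λ _ → 0) ≡ 0
sumFin-zero zero    = refl
sumFin-zero (suc n) = sumFin-zero n

sumFin-comm : ∀ {m n} (f : Fin m → Fin n → ℕ) →
              sumFin (λ i → sumFin (f i)) ≡ sumFin (λ j → sumFin (λ i → f i j))
sumFin-comm f = begin
  sumFin (λ i → sumFin (f i))          ≡⟨ sumFin-cong (sumFin≡sum ∘ f) ⟩
  sumFin (λ i → sum (f i))             ≡⟨ sumFin≡sum (λ i → sum (f i)) ⟩
  sum (λ i → sum (f i))                ≡⟨ ∑-comm f ⟩
  sum (λ j → sum (λ i → f i j))        ≡⟨ sumFin≡sum (λ j → sum (λ i → f i j)) ⟨
  sumFin (λ j → sum (λ i → f i j))     ≡⟨ sumFin-cong (λ j → sumFin≡sum (λ i → f i j)) ⟨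
  sumFin (λ j → sumFin (λ i → f i j))  ∎
  where open ≡-Reasoning

sumFin-punchIn : ∀ {n} (f : Fin (suc n) → ℕ) i → sumFin f ≡ f i + sumFin (f ∘ punchIn i)
sumFin-punchIn f i = begin
  sumFin f                      ≡⟨ sumFin≡sum f ⟩
  sum f                         ≡⟨ sum-remove f ⟩
  f i + sum (f ∘ punchIn i)     ≡⟨ cong (f i +_) (sumFin≡sum (f ∘ punchIn i)) ⟨
  f i + sumFin (f ∘ punchIn i)  ∎
  where open ≡-Reasoning

sumFin-↑ : ∀ {m n} (f : Fin (m + n) → ℕ) →
           sumFin f ≡ sumFin (λ i → f (i ↑ˡ n)) + sumFin (λ j → f (m ↑ʳ j))
sumFin-↑ {zero}  f = refl
sumFin-↑ {suc m} f =
  trans (cong (f fzero +_) (sumFin-↑ {m} (f ∘ fsuc))) (sym (+-assoc (f fzero) _ _))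

sumFin-combine : ∀ {m n} (f : Fin (m * n) → ℕ) →
                 sumFin f ≡ sumFin (λ (i : Fin m) → sumFin (λ (j : Fin n) → f (combine i j)))
sumFin-combine {zero}      f = refl
sumFin-combine {suc m} {n} f = trans (sumFin-↑ {n} f)
  (cong (sumFin (λ j → f (j ↑ˡ m * n)) +_) (sumFin-combine {m} (λ x → f (n ↑ʳ x))))

sumFin-lowerBound : ∀ {n a} (f : Fin n → ℕ) → (∀ i → a ≤ f i) → n * a ≤ sumFin f
sumFin-lowerBound {zero}  f a≤f = z≤n
sumFin-lowerBound {suc n} f a≤f =
  +-mono-≤ (a≤f fzero) (sumFin-lowerBound (f ∘ fsuc) (a≤f ∘ fsuc))

count-remQuot : ∀ {m} n (p : Fin m × Fin n → Bool) →
                count (p ∘ remQuot n) ≡ sumFin (λ i → count (λ j → p (i , j)))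
count-remQuot {m} n p = trans (sumFin-combine {m} (ind ∘ p ∘ remQuot n))
  (sumFin-cong λ i → sumFin-cong λ j → cong (ind ∘ p) (Fin.remQuot-combine i j))

count-∧-≟ : ∀ {n} b (x : Fin n) → count (λ y → b ∧ does (x Fin.≟ y)) ≡ ind b
count-∧-≟ {n}     false x        = sumFin-zero n
count-∧-≟ {suc n} true  fzero    = cong suc (sumFin-zero n)
count-∧-≟         true  (fsuc x) = count-∧-≟ true x

remQuot-injective : ∀ {m} n → Injective _≡_ _≡_ (remQuot {m} n)
remQuot-injective n = Injection.injective (↔⇒↣ Fin.*↔×)

does⇒proof : ∀ {p} {P : Set p} (P? : Dec P) → T (does P?) → P
does⇒proof (yes p) _ = p

enumerate : ∀ {n} (p : Fin n → Bool) →
  Σ (Fin (count p) → Fin n) λ e → Injective _≡_ _≡_ e × (∀ i → T (p (e i)))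
enumerate {zero}  p = (λ ()) , (λ { {()} }) , (λ ())
enumerate {suc n} p with enumerate (p ∘ fsuc) | p fzero in p0
... | e , e-inj , e∈p | false = fsuc ∘ e , e-inj ∘ Fin.suc-injective , e∈p
... | e , e-inj , e∈p | true  = e′ , e′-inj , e′∈p
  where
  e′ : Fin (suc (count (p ∘ fsuc))) → Fin (suc n)
  e′ fzero    = fzero
  e′ (fsuc i) = fsuc (e i)
  e′-inj : Injective _≡_ _≡_ e′
  e′-inj {fzero}  {fzero}  _  = refl
  e′-inj {fsuc i} {fsuc j} eq = cong fsuc (e-inj (Fin.suc-injective eq))
  e′∈p : ∀ i → T (p (e′ i))
  e′∈p fzero    rewrite p0 = _
  e′∈p (fsuc i) = e∈p i

vertices-outside : ∀ {n} (X : Fin n → Bool) {k} → k ≤ count (λ v → not (X v)) →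
  Σ (Fin k → Fin n) λ ι → Injective _≡_ _≡_ ι × (∀ j → X (ι j) ≡ false)
vertices-outside X {k} k≤|Y| with e , e-inj , e∈Y ← enumerate (λ v → not (X v)) =
  e ∘ embed , embed-inj ∘ e-inj , λ j → Equivalence.to T-not-≡ (e∈Y (embed j))
  where
  embed : Fin k → Fin (count (λ v → not (X v)))
  embed j = inject≤ j k≤|Y|
  embed-inj : Injective _≡_ _≡_ embed
  embed-inj {i} {j} = Fin.inject≤-injective k≤|Y| k≤|Y| i j

∃-minimiser : ∀ {n} (f : Fin (suc n) → ℕ) → ∃ λ i → ∀ j → f i ≤ f j
∃-minimiser {zero}  f = fzero , λ { fzero → ≤-refl }
∃-minimiser {suc n} f with ∃-minimiser (f ∘ fsuc)
... | i , min with f fzero ≤? f (fsuc i)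
...   | yes f0≤ = fzero  , λ { fzero → ≤-refl ; (fsuc j) → ≤-trans f0≤ (min j) }
...   | no  f0≰ = fsuc i , λ { fzero → <⇒≤ (≰⇒> f0≰) ; (fsuc j) → min j }

-- Discarding a lightest weight never lowers the average of the others.
heaviest-subfamily : ∀ n (w : Fin n → ℕ) k → k ≤ n →
  Σ (Fin k → Fin n) λ σ → Injective _≡_ _≡_ σ × k * sumFin w ≤ n * sumFin (w ∘ σ)
heaviest-subfamily zero    w zero z≤n = (λ ()) , (λ { {()} }) , z≤n
heaviest-subfamily (suc n) w k k≤1+n with k ≟ suc n
... | yes refl = (λ i → i) , (λ eq → eq) , ≤-refl
... | no  k≢1+n with ∃-minimiser w
...   | i , min with heaviest-subfamily n (w ∘ punchIn i) k (s≤s⁻¹ (≤∧≢⇒< k≤1+n k≢1+n))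
...     | σ , σ-inj , avg = punchIn i ∘ σ , σ-inj ∘ Fin.punchIn-injective i _ _ , (begin
  k * sumFin w                          ≡⟨ cong (k *_) (sumFin-punchIn w i) ⟩
  k * (w i + sumFin (w ∘ punchIn i))    ≡⟨ *-distribˡ-+ k (w i) _ ⟩
  k * w i + k * sumFin (w ∘ punchIn i)  ≤⟨ +-mono-≤ (sumFin-lowerBound _ (min ∘ punchIn i ∘ σ)) avg ⟩
  suc n * sumFin (w ∘ punchIn i ∘ σ)    ∎)
  where open ≤-Reasoning

module _ {a ℓ} {A : Set a} {_≺_ : Rel A ℓ} (asym : Asymmetric _≺_) where

  ordered-pair-unique : ∀ {u v u′ v′ p r} → u ≺ v → u′ ≺ v′ →
    (u , v) ≡ (p , r) ⊎ (u , v) ≡ (r , p) → (u′ , v′) ≡ (p , r) ⊎ (u′ , v′) ≡ (r , p) →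
    (u , v) ≡ (u′ , v′)
  ordered-pair-unique _   _     (inj₁ refl) (inj₁ refl) = refl
  ordered-pair-unique u≺v u′≺v′ (inj₁ refl) (inj₂ refl) = ⊥-elim (asym u≺v u′≺v′)
  ordered-pair-unique u≺v u′≺v′ (inj₂ refl) (inj₁ refl) = ⊥-elim (asym u≺v u′≺v′)
  ordered-pair-unique _   _     (inj₂ refl) (inj₂ refl) = refl

pair-of-members : ∀ {a} {A : Set a} {u v p r : A} → p ≢ r → p ≡ u ⊎ p ≡ v → r ≡ u ⊎ r ≡ v →
  (u , v) ≡ (p , r) ⊎ (u , v) ≡ (r , p)
pair-of-members p≢r (inj₁ refl) (inj₁ refl) = ⊥-elim (p≢r refl)
pair-of-members p≢r (inj₁ refl) (inj₂ refl) = inj₁ refl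
pair-of-members p≢r (inj₂ refl) (inj₁ refl) = inj₂ refl
pair-of-members p≢r (inj₂ refl) (inj₂ refl) = ⊥-elim (p≢r refl)

module _ {n} (G : Graph n) where

  adj? : Decidable (λ u v → adj G u v ≡ true)
  adj? u v = map T-≡ (T? (adj G u v))

  OrientedEdge : Fin n → Fin n → Set
  OrientedEdge u v = u < v × adj G u v ≡ true

  orientedEdge? : Decidable OrientedEdge
  orientedEdge? u v = u Fin.<? v ×-dec adj? u v

induced-adj⁻ : ∀ {n} (G : Graph n) (X : Fin n → Bool) {u v} → adj (induced G X) u v ≡ true →
  X u ≡ true × X v ≡ true × adj G u v ≡ true
induced-adj⁻ G X {u} {v} uv with X u | X v
... | true  | true  = refl , refl , uv
induced-adj⁻ G X () | false | _
induced-adj⁻ G X () | true  | false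

module ColourClasses {n χ} {G : Graph n} (C : EdgeColouring G χ) where
  open EdgeColouring C

  col-injectiveʳ : ∀ {u v w} → adj G u v ≡ true → adj G u w ≡ true → col u v ≡ col u w → v ≡ w
  col-injectiveʳ {u} {v} {w} uv uw eq =
    decidable-stable (v Fin.≟ w) (λ v≢w → proper u v w uv uw v≢w eq)

  ColouredEdge : Fin χ → Fin n → Fin n → Set
  ColouredEdge γ u v = OrientedEdge G u v × col u v ≡ γ

  colouredEdge? : ∀ γ → Decidable (ColouredEdge γ)
  colouredEdge? γ u v = orientedEdge? G u v ×-dec col u v Fin.≟ γ

  classSize : Fin χ → ℕ
  classSize γ = sumFin λ u → count λ v → does (colouredEdge? γ u v)

  edgeCount≡∑classSize : edgeCount G ≡ sumFin classSize
  edgeCount≡∑classSize = sym (begin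
    sumFin (λ γ → sumFin λ u → sumFin λ v → ind (edge u v ∧ does (col u v Fin.≟ γ)))
      ≡⟨ sumFin-comm (λ γ u → sumFin λ v → ind (edge u v ∧ does (col u v Fin.≟ γ))) ⟩
    sumFin (λ u → sumFin λ γ → sumFin λ v → ind (edge u v ∧ does (col u v Fin.≟ γ)))
      ≡⟨ sumFin-cong (λ u → sumFin-comm (λ γ v → ind (edge u v ∧ does (col u v Fin.≟ γ)))) ⟩
    sumFin (λ u → sumFin λ v → sumFin λ γ → ind (edge u v ∧ does (col u v Fin.≟ γ)))
      ≡⟨ sumFin-cong (λ u → sumFin-cong λ v → count-∧-≟ (edge u v) (col u v)) ⟩
    edgeCount G ∎)
    where
    open ≡-Reasoning
    edge : Fin n → Fin n → Bool
    edge u v = does (orientedEdge? G u v)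

  other-endpoint : ∀ {γ u v x} → ColouredEdge γ u v → x ≡ u ⊎ x ≡ v →
    ∃ λ o → adj G x o ≡ true × col x o ≡ γ × ((u , v) ≡ (x , o) ⊎ (u , v) ≡ (o , x))
  other-endpoint {v = v} ((_ , uv) , uv∈γ) (inj₁ refl) = v , uv , uv∈γ , inj₁ refl
  other-endpoint {u = u} {v} ((_ , uv) , uv∈γ) (inj₂ refl) =
    u , trans (Graph.sym G v u) uv , trans (sym (col-sym u v uv)) uv∈γ , inj₂ refl

  coloured-edges-sharing-endpoint : ∀ {γ u v u′ v′ x} →
    ColouredEdge γ u v → ColouredEdge γ u′ v′ → x ≡ u ⊎ x ≡ v → x ≡ u′ ⊎ x ≡ v′ →
    (u , v) ≡ (u′ , v′)
  coloured-edges-sharing-endpoint e e′ x∈e x∈e′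
    with o  , xo  , xo∈γ  , e≡xo   ← other-endpoint e  x∈e
       | o′ , xo′ , xo′∈γ , e′≡xo′ ← other-endpoint e′ x∈e′
    with refl ← col-injectiveʳ xo xo′ (trans xo∈γ (sym xo′∈γ))
    = ordered-pair-unique Fin.<-asym (proj₁ (proj₁ e)) (proj₁ (proj₁ e′)) e≡xo e′≡xo′

-- σ selects the colour classes that are used and ι gives each of them its own apex in Y.
module SlotPacking {n χ k} (G : Graph n) (X : Fin n → Bool)
  (join : ∀ x y → X x ≡ true → X y ≡ false → adj G x y ≡ true)
  (C : EdgeColouring (induced G X) χ)
  {σ : Fin k → Fin χ} (σ-inj : Injective _≡_ _≡_ σ)
  {ι : Fin k → Fin n} (ι-inj : Injective _≡_ _≡_ ι) (ι∈Y : ∀ j → X (ι j) ≡ false) where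

  open ColourClasses C

  Slot : Set
  Slot = Fin k × Fin n × Fin n

  Filled : Slot → Set
  Filled (j , u , v) = ColouredEdge (σ j) u v

  filled? : ∀ s → Dec (Filled s)
  filled? (j , u , v) = colouredEdge? (σ j) u v

  triangle : ∀ s → Filled s → Triangle G
  triangle (j , u , v) ((_ , uv) , _) =
    let Xu , Xv , G-uv = induced-adj⁻ G X uv in record
    { a = u ; b = v ; c = ι j ; ab = G-uv
    ; bc = join v (ι j) Xv (ι∈Y j) ; ac = join u (ι j) Xu (ι∈Y j) }

  twoInX : ∀ s (h : Filled s) → TwoInX X (triangle s h)
  twoInX (j , u , v) ((_ , uv) , _) with Xu , Xv , _ ← induced-adj⁻ G X uv
    rewrite Xu | Xv | ι∈Y j = refl

  ∈X⇒endpoint : ∀ {j u v} (h : Filled (j , u , v)) {p} → p ∈T triangle (j , u , v) h →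
    X p ≡ true → p ≡ u ⊎ p ≡ v
  ∈X⇒endpoint h (inj₁ p≡u)          _  = inj₁ p≡u
  ∈X⇒endpoint h (inj₂ (inj₁ p≡v))   _  = inj₂ p≡v
  ∈X⇒endpoint h (inj₂ (inj₂ refl)) Xp with () ← trans (sym Xp) (ι∈Y _)

  ∈Y⇒apex : ∀ {j u v} (h : Filled (j , u , v)) {p} → p ∈T triangle (j , u , v) h →
    X p ≡ false → p ≡ ι j
  ∈Y⇒apex ((_ , uv) , _) (inj₁ refl) Xp
    with () ← trans (sym Xp) (proj₁ (induced-adj⁻ G X uv))
  ∈Y⇒apex ((_ , uv) , _) (inj₂ (inj₁ refl)) Xp
    with () ← trans (sym Xp) (proj₁ (proj₂ (induced-adj⁻ G X uv)))
  ∈Y⇒apex h (inj₂ (inj₂ p≡ιj)) _ = p≡ιj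

  shared-X-edge⇒same-slot : ∀ {s s′} (h : Filled s) (h′ : Filled s′) {p r} → p ≢ r →
    p ∈T triangle s h → r ∈T triangle s h → p ∈T triangle s′ h′ → r ∈T triangle s′ h′ →
    X p ≡ true → X r ≡ true → s ≡ s′
  shared-X-edge⇒same-slot {j , u , v} h h′ p≢r p∈ r∈ p∈′ r∈′ Xp Xr
    with refl ← ordered-pair-unique Fin.<-asym (proj₁ (proj₁ h)) (proj₁ (proj₁ h′))
                  (pair-of-members p≢r (∈X⇒endpoint h  p∈  Xp) (∈X⇒endpoint h  r∈  Xr))
                  (pair-of-members p≢r (∈X⇒endpoint h′ p∈′ Xp) (∈X⇒endpoint h′ r∈′ Xr))
    = cong (_, u , v) (σ-inj (trans (sym (proj₂ h)) (proj₂ h′)))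

  shared-cross-edge⇒same-slot : ∀ {s s′} (h : Filled s) (h′ : Filled s′) {x y} →
    x ∈T triangle s h → y ∈T triangle s h → x ∈T triangle s′ h′ → y ∈T triangle s′ h′ →
    X x ≡ true → X y ≡ false → s ≡ s′
  shared-cross-edge⇒same-slot {j , _} h h′ x∈ y∈ x∈′ y∈′ Xx Xy
    with refl ← ι-inj (trans (sym (∈Y⇒apex h y∈ Xy)) (∈Y⇒apex h′ y∈′ Xy))
    = cong (j ,_) (coloured-edges-sharing-endpoint h h′ (∈X⇒endpoint h x∈ Xx) (∈X⇒endpoint h′ x∈′ Xx))

  shared-edge⇒same-slot : ∀ {s s′} (h : Filled s) (h′ : Filled s′) {p r} → p ≢ r →
    p ∈T triangle s h → r ∈T triangle s h → p ∈T triangle s′ h′ → r ∈T triangle s′ h′ → s ≡ s′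
  shared-edge⇒same-slot h h′ {p} {r} p≢r p∈ r∈ p∈′ r∈′ with X p in Xp | X r in Xr
  ... | true  | true  = shared-X-edge⇒same-slot h h′ p≢r p∈ r∈ p∈′ r∈′ Xp Xr
  ... | true  | false = shared-cross-edge⇒same-slot h h′ p∈ r∈ p∈′ r∈′ Xp Xr
  ... | false | true  = shared-cross-edge⇒same-slot h h′ r∈ p∈ r∈′ p∈′ Xr Xp
  ... | false | false = ⊥-elim (p≢r (trans (∈Y⇒apex h p∈ Xp) (sym (∈Y⇒apex h r∈ Xr))))

  decode : Fin (k * (n * n)) → Slot
  decode x = map₂ (remQuot n) (remQuot (n * n) x)

  decode-injective : Injective _≡_ _≡_ decode
  decode-injective eq =
    remQuot-injective (n * n) (cong₂ _,_ (cong proj₁ eq) (remQuot-injective n (cong proj₂ eq)))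

  count-filled : count (does ∘ filled? ∘ decode) ≡ sumFin (classSize ∘ σ)
  count-filled = trans (count-remQuot (n * n) (λ (j , y) → does (filled? (j , remQuot n y))))
    (sumFin-cong λ j → count-remQuot n (λ (u , v) → does (filled? (j , u , v))))

  packing : Σ ℕ λ m → Σ (Fin m → Triangle G) λ t →
    IsPacking t × (∀ i → TwoInX X (t i)) × m ≡ sumFin (classSize ∘ σ)
  packing with e , e-inj , e-filled ← enumerate (does ∘ filled? ∘ decode) =
    _ , t , isPacking , (λ i → twoInX _ (filled i)) , count-filled
    where
    filled : ∀ i → Filled (decode (e i))
    filled i = does⇒proof (filled? (decode (e i))) (e-filled i)
    t : Fin (count (does ∘ filled? ∘ decode)) → Triangle G
    t i = triangle (decode (e i)) (filled i)
    isPacking : IsPacking t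
    isPacking i i′ i≢i′ p r p≢r p∈ r∈ p∈′ r∈′ = i≢i′ (e-inj (decode-injective
      (shared-edge⇒same-slot (filled i) (filled i′) p≢r p∈ r∈ p∈′ r∈′)))

lemma1 : ∀ {n} (G : Graph n) (X : Fin n → Bool) →
    (∀ x y → X x ≡ true → X y ≡ false → adj G x y ≡ true) →
    (χ : ℕ) → IsChromaticIndex (induced G X) χ →
    Σ ℕ (λ m → Σ (Fin m → Triangle G) (λ t →
      IsPacking t × (∀ i → TwoInX X (t i)) ×
      (χ ⊓ count (λ v → not (X v))) * edgeCount (induced G X) ≤ m * χ))
lemma1 G X join χ (C , _) =
  let k : ℕ
      k = χ ⊓ count (λ v → not (X v))
      σ , σ-inj , heavy = heaviest-subfamily χ classSize k (m⊓n≤m χ _)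
      ι , ι-inj , ι∈Y = vertices-outside X (m⊓n≤n χ _)
      m , t , isPacking , twoInX , m≡ = SlotPacking.packing G X join C σ-inj ι-inj ι∈Y
  in m , t , isPacking , twoInX , (begin
    k * edgeCount (induced G X)  ≡⟨ cong (k *_) edgeCount≡∑classSize ⟩
    k * sumFin classSize         ≤⟨ heavy ⟩
    χ * sumFin (classSize ∘ σ)   ≡⟨ cong (χ *_) m≡ ⟨
    χ * m                        ≡⟨ *-comm χ m ⟩
    m * χ                        ∎)
  where
  open ColourClasses C
  open ≤-Reasoning
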